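{- Let $q$ be a prime power and $n,k,d,i$ integers with $d\ge 1$, $k\geq i\geq d+1$ and $n\geq 2k+1$. Then $$q^{\binom{i}{2}-ki}\left[n-k-i\atop k-i\right]_q\leq q^{\binom{d+1}{2}-k(d+1)}\left[n-k-d-1\atop k-d-1\right]_q<\frac{q^{k}-q^{d}}{q^{n}-q^{k}}\left[n-k\atop k\right]_q.$$
   Context: Gaussian binomial: $\left[m\atop k\right]_q=\prod_{t=0}^{k-1}\frac{q^{m-t}-1}{q^{k-t}-1}$ for positive integer $k$, $\left[m\atop 0\right]_q=1$. -}

module Defs where

open import Data.Nat as ℕ using (ℕ; zero; suc; _≤_)
open import Data.Nat.Primality using (Prime)
open import Data.Integer as ℤ using (ℤ; +_; -[1+_])
open import Data.Rational using (ℚ; 0ℚ; 1ℚ; _/_; _*_; _-_; _÷_; ≢-nonZero)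
open import Data.Rational.Properties using (_≟_)
open import Data.List using (List; foldr; map; upTo)
open import Data.Product using (Σ; _×_)
open import Relation.Binary.PropositionalEquality using (_≡_)
open import Relation.Nullary using (yes; no)

IsPrimePower : ℕ → Set
IsPrimePower q = Σ ℕ λ p → Σ ℕ λ m → Prime p × (1 ≤ m) × (q ≡ p ℕ.^ m)

toℚ : ℕ → ℚ
toℚ n = (+ n) / 1

-- total division on ℚ (value 0 when dividing by 0; only used with nonzero divisors)
_/'_ : ℚ → ℚ → ℚ
x /' y with y ≟ 0ℚ
... | yes _ = 0ℚ
... | no y≢0 = _÷_ x y {{≢-nonZero y≢0}}

_^ℕ_ : ℚ → ℕ → ℚ
x ^ℕ zero = 1ℚ
x ^ℕ suc n = x * (x ^ℕ n)

_^ℤ_ : ℚ → ℤ → ℚ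
x ^ℤ (+ n) = x ^ℕ n
x ^ℤ -[1+ n ] = 1ℚ /' (x ^ℕ suc n)

prodℚ : List ℚ → ℚ
prodℚ = foldr _*_ 1ℚ

gauss : ℚ → ℕ → ℕ → ℚ
gauss q m zero = 1ℚ
gauss q m (suc k) =
  prodℚ (map (λ t → ((q ^ℕ (m ℕ.∸ t)) - 1ℚ) /' ((q ^ℕ (suc k ℕ.∸ t)) - 1ℚ)) (upTo (suc k)))

-- Write N = n − k and f(i) = q^(C(i,2) − k i) [N − i, k − i]_q.  Peeling one factor off the
-- Gaussian binomial, [m+1, j+1]_q = (q^(m+1) − 1)/(q^(j+1) − 1) · [m, j]_q with the ratio at least
-- q^(m−j) ≥ 1, shows that f(i+1) ≤ f(i), which is the first inequality.  Peeling off D = d + 1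
-- factors gives [N, k]_q ≥ q^(D (N−k)) [N − D, k − D]_q, so the second inequality reduces to
-- q^(C(D,2) − kD) < (q^k − q^d)/(q^n − q^k) · q^(D (N−k)); as q ≥ 2 we have q^k − q^d ≥ q^(k−1)
-- and q^n − q^k < q^n, which leaves the exponent inequality C(D,2) + n ≤ (k−1) + D(N−k) + kD.
module Submission where

open import Defs
open import Data.Nat using (ℕ; _≤_; _+_; _*_; _∸_)
open import Data.Nat.Combinatorics using (_C_)
open import Data.Integer using (+_) renaming (_-_ to _-ℤ_)
open import Data.Rational using (ℚ) renaming (_≤_ to _≤ℚ_; _<_ to _<ℚ_; _*_ to _*ℚ_; _-_ to _-ℚ_)
open import Data.Product using (_×_)

open import Data.Nat using (suc; zero; pred; z≤n; s≤s; _<_; _^_; _≤′_; ≤′-refl; ≤′-step; nonTrivial⇒n>1; nonTrivial⇒nonZero)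
import Data.Nat.Properties as ℕP
import Data.Nat.Solver as ℕSolver
open import Data.Nat.Combinatorics using (nCk+nC[k+1]≡[n+1]C[k+1]; nC1≡n)
open import Data.Nat.Primality using (prime⇒nonTrivial)
open import Data.Nat.Coprimality using (1-coprimeTo) renaming (sym to coprime-sym)
open import Data.Integer as ℤ using (_⊖_)
import Data.Integer.Properties as ℤP
open import Data.Rational as ℚ using (0ℚ; 1ℚ; mkℚ; *≤*; *<*; nonNegative; positive) renaming (_+_ to _+ℚ_; -_ to -ℚ_)
import Data.Rational.Properties as ℚP
import Data.Rational.Solver as ℚSolver
open import Data.List.Properties using (map-applyUpTo; map-upTo)
open import Data.Product using (_,_)
open import Relation.Binary.PropositionalEquality using (_≡_; _≢_; refl; sym; trans; cong; subst; subst₂; module ≡-Reasoning)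
open import Relation.Nullary using (yes; no)
open import Data.Empty using (⊥-elim)

suc[n]C2≡n+nC2 : ∀ n → suc n C 2 ≡ n + n C 2
suc[n]C2≡n+nC2 n = trans (sym (nCk+nC[k+1]≡[n+1]C[k+1] n 1)) (cong (_+ n C 2) (nC1≡n n))

suc[n]C2≤n*n : ∀ n → suc n C 2 ≤ n * n
suc[n]C2≤n*n zero = z≤n
suc[n]C2≤n*n (suc n) = begin
  suc (suc n) C 2    ≡⟨ suc[n]C2≡n+nC2 (suc n) ⟩
  suc n + suc n C 2  ≤⟨ ℕP.+-monoʳ-≤ (suc n) (suc[n]C2≤n*n n) ⟩
  suc n + n * n      ≤⟨ ℕP.+-monoʳ-≤ (suc n) (ℕP.*-monoʳ-≤ n (ℕP.n≤1+n n)) ⟩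
  suc n * suc n      ∎
  where open ℕP.≤-Reasoning

2*k+1≤n⇒k+k<n : ∀ {k n} → 2 * k + 1 ≤ n → k + k < n
2*k+1≤n⇒k+k<n {k} {n} = subst (_≤ n) (solve 1 (λ k → con 2 :* k :+ con 1 := con 1 :+ (k :+ k)) refl k)
  where open ℕSolver.+-*-Solver

exponent-bound : ∀ {D k n} → 2 ≤ D → D ≤ k → k + k < n →
                 D C 2 + n ≤ pred k + (D * (n ∸ k ∸ k) + k * D)
exponent-bound {suc d} {suc k} {n} (s≤s 1≤d) (s≤s d≤k) k+k<n = begin
  c + n                                  ≡⟨ cong (_+_ c) (sym n≡2k+m) ⟩
  c + (suc k + suc k + m)                ≡⟨ solve 3 (λ k m c → c :+ ((con 1 :+ k) :+ (con 1 :+ k) :+ m)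
                                                        := k :+ ((m :+ con 1) :+ ((con 1 :+ k) :+ c))) refl k m c ⟩
  k + ((m + 1) + (suc k + c))            ≤⟨ ℕP.+-monoʳ-≤ k (ℕP.+-mono-≤ m+1≤D*m (ℕP.+-monoʳ-≤ (suc k) c≤k*d)) ⟩
  k + (suc d * m + (suc k + suc k * d))  ≡⟨ cong (λ x → k + (suc d * m + x)) (sym (ℕP.*-suc (suc k) d)) ⟩
  k + (suc d * m + suc k * suc d)        ∎
  where
  open ℕP.≤-Reasoning
  open ℕSolver.+-*-Solver
  c = suc d C 2
  m = n ∸ suc k ∸ suc k
  n≡2k+m : suc k + suc k + m ≡ n
  n≡2k+m = trans (cong (_+_ (suc k + suc k)) (ℕP.∸-+-assoc n (suc k) (suc k))) (ℕP.m+[n∸m]≡n (ℕP.<⇒≤ k+k<n))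
  1≤m : 1 ≤ m
  1≤m = subst (1 ≤_) (sym (ℕP.∸-+-assoc n (suc k) (suc k))) (ℕP.m+n≤o⇒m≤o∸n 1 k+k<n)
  m+1≤D*m : m + 1 ≤ suc d * m
  m+1≤D*m = ℕP.+-monoʳ-≤ m (ℕP.*-mono-≤ 1≤d 1≤m)
  c≤k*d : c ≤ suc k * d
  c≤k*d = ℕP.≤-trans (suc[n]C2≤n*n d) (ℕP.*-monoˡ-≤ d (ℕP.≤-trans d≤k (ℕP.n≤1+n k)))

prime-power⇒2≤ : ∀ {q} → IsPrimePower q → 2 ≤ q
prime-power⇒2≤ (p , suc m , p-prime , _ , refl) = ℕP.≤-trans (nonTrivial⇒n>1 p) (ℕP.m≤m*n p (p ^ m) {{ℕP.m^n≢0 p m}})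
  where instance
  _ = prime⇒nonTrivial p-prime
  _ = nonTrivial⇒nonZero p


*-monoˡ-≤-0≤ : ∀ {p q} r → 0ℚ ≤ℚ r → p ≤ℚ q → r *ℚ p ≤ℚ r *ℚ q
*-monoˡ-≤-0≤ r 0≤r = ℚP.*-monoˡ-≤-nonNeg r {{nonNegative 0≤r}}

*-monoʳ-≤-0≤ : ∀ {p q} r → 0ℚ ≤ℚ r → p ≤ℚ q → p *ℚ r ≤ℚ q *ℚ r
*-monoʳ-≤-0≤ r 0≤r = ℚP.*-monoʳ-≤-nonNeg r {{nonNegative 0≤r}}

*-mono-≤-0≤ : ∀ {p q r s} → 0ℚ ≤ℚ p → 0ℚ ≤ℚ s → p ≤ℚ q → r ≤ℚ s → p *ℚ r ≤ℚ q *ℚ s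
*-mono-≤-0≤ {p} {s = s} 0≤p 0≤s p≤q r≤s = ℚP.≤-trans (*-monoˡ-≤-0≤ p 0≤p r≤s) (*-monoʳ-≤-0≤ s 0≤s p≤q)

*-monoˡ-<-0< : ∀ {p q} r → 0ℚ <ℚ r → p <ℚ q → r *ℚ p <ℚ r *ℚ q
*-monoˡ-<-0< r 0<r = ℚP.*-monoʳ-<-pos r {{positive 0<r}}

*-monoʳ-<-0< : ∀ {p q} r → 0ℚ <ℚ r → p <ℚ q → p *ℚ r <ℚ q *ℚ r
*-monoʳ-<-0< r 0<r = ℚP.*-monoˡ-<-pos r {{positive 0<r}}

*-cancelʳ-≤-0< : ∀ {p q} r → 0ℚ <ℚ r → p *ℚ r ≤ℚ q *ℚ r → p ≤ℚ q
*-cancelʳ-≤-0< r 0<r = ℚP.*-cancelʳ-≤-pos r {{positive 0<r}}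

*-cancelʳ-<-0< : ∀ {p q} r → 0ℚ <ℚ r → p *ℚ r <ℚ q *ℚ r → p <ℚ q
*-cancelʳ-<-0< r 0<r = ℚP.*-cancelʳ-<-nonNeg r {{nonNegative (ℚP.<⇒≤ 0<r)}}

0<*0< : ∀ {p q} → 0ℚ <ℚ p → 0ℚ <ℚ q → 0ℚ <ℚ p *ℚ q
0<*0< {p} {q} 0<p 0<q = ℚP.<-respˡ-≡ (ℚP.*-zeroˡ q) (*-monoʳ-<-0< q 0<q 0<p)

0<⇒≢0 : ∀ {p} → 0ℚ <ℚ p → p ≢ 0ℚ
0<⇒≢0 0<p p≡0 = ℚP.<-irrefl (sym p≡0) 0<p

p<q⇒0<q-p : ∀ {p q} → p <ℚ q → 0ℚ <ℚ q -ℚ p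
p<q⇒0<q-p {p} 1<q = ℚP.<-respˡ-≡ (ℚP.+-inverseʳ p) (ℚP.+-monoˡ-< (-ℚ p) 1<q)

0<p⇒q-p<q : ∀ {p q} → 0ℚ <ℚ p → q -ℚ p <ℚ q
0<p⇒q-p<q {p} {q} 0<p = subst (q -ℚ p <ℚ_) (ℚP.+-identityʳ q) (ℚP.+-monoʳ-< q (ℚP.neg-antimono-< 0<p))

p+r≤q⇒p≤q-r : ∀ {p q r} → p +ℚ r ≤ℚ q → p ≤ℚ q -ℚ r
p+r≤q⇒p≤q-r {p} {q} {r} h =
  subst (_≤ℚ q -ℚ r) (solve 2 (λ p r → (p :+ r) :- r := p) refl p r) (ℚP.+-monoˡ-≤ (-ℚ r) h)
  where open ℚSolver.+-*-Solver

/'-*-cancelʳ : ∀ p {q} → q ≢ 0ℚ → (p /' q) *ℚ q ≡ p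
/'-*-cancelʳ p {q} q≢0 with q ℚP.≟ 0ℚ
... | yes q≡0 = ⊥-elim (q≢0 q≡0)
... | no q≢0′ = trans (ℚP.*-assoc p _ q) (trans (cong (p *ℚ_) (ℚP.*-inverseˡ q {{ℚ.≢-nonZero q≢0′}})) (ℚP.*-identityʳ p))

0</'0< : ∀ {p q} → 0ℚ <ℚ p → 0ℚ <ℚ q → 0ℚ <ℚ p /' q
0</'0< {p} {q} 0<p 0<q = *-cancelʳ-<-0< q 0<q
  (subst₂ _<ℚ_ (sym (ℚP.*-zeroˡ q)) (sym (/'-*-cancelʳ p (0<⇒≢0 0<q))) 0<p)

toℚ-mono-≤ : ∀ {m n} → m ≤ n → toℚ m ≤ℚ toℚ n
toℚ-mono-≤ {m} {n} m≤n = subst₂ _≤ℚ_ (sym (toℚ≡mkℚ m)) (sym (toℚ≡mkℚ n))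
  (*≤* (subst₂ ℤ._≤_ (sym (ℤP.*-identityʳ (+ m))) (sym (ℤP.*-identityʳ (+ n))) (ℤ.+≤+ m≤n)))
  where
  toℚ≡mkℚ : ∀ n → toℚ n ≡ mkℚ (+ n) 0 (coprime-sym (1-coprimeTo n))
  toℚ≡mkℚ n = ℚP.normalize-coprime (coprime-sym (1-coprimeTo n))

^ℕ-+ : ∀ x m n → x ^ℕ (m + n) ≡ x ^ℕ m *ℚ x ^ℕ n
^ℕ-+ x zero n = sym (ℚP.*-identityˡ (x ^ℕ n))
^ℕ-+ x (suc m) n = trans (cong (x *ℚ_) (^ℕ-+ x m n)) (sym (ℚP.*-assoc x (x ^ℕ m) (x ^ℕ n)))

0<^ℕ : ∀ {x} → 0ℚ <ℚ x → ∀ m → 0ℚ <ℚ x ^ℕ m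
0<^ℕ 0<x zero = ℚP.positive⁻¹ 1ℚ
0<^ℕ 0<x (suc m) = 0<*0< 0<x (0<^ℕ 0<x m)

1≤^ℕ : ∀ {x} → 1ℚ ≤ℚ x → ∀ m → 1ℚ ≤ℚ x ^ℕ m
1≤^ℕ 1≤x zero = ℚP.≤-refl
1≤^ℕ 1≤x (suc m) = *-mono-≤-0≤ (ℚP.nonNegative⁻¹ 1ℚ) (ℚP.≤-trans (ℚP.nonNegative⁻¹ 1ℚ) (1≤^ℕ 1≤x m)) 1≤x (1≤^ℕ 1≤x m)

^ℕ-monoʳ-≤ : ∀ {x m n} → 1ℚ ≤ℚ x → m ≤ n → x ^ℕ m ≤ℚ x ^ℕ n
^ℕ-monoʳ-≤ {x} {m} 1≤x m≤n with o , refl ← ℕP.m≤n⇒∃[o]m+o≡n m≤n = begin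
  x ^ℕ m                 ≡⟨ sym (ℚP.*-identityʳ (x ^ℕ m)) ⟩
  x ^ℕ m *ℚ 1ℚ           ≤⟨ *-monoˡ-≤-0≤ (x ^ℕ m) (ℚP.≤-trans (ℚP.nonNegative⁻¹ 1ℚ) (1≤^ℕ 1≤x m)) (1≤^ℕ 1≤x o) ⟩
  x ^ℕ m *ℚ x ^ℕ o       ≡⟨ sym (^ℕ-+ x m o) ⟩
  x ^ℕ (m + o)           ∎
  where open ℚP.≤-Reasoning

^ℕ-monoʳ-< : ∀ {x m n} → 1ℚ <ℚ x → m < n → x ^ℕ m <ℚ x ^ℕ n
^ℕ-monoʳ-< {x} {m} 1<x m<n = ℚP.<-≤-trans x^m<x^[1+m] (^ℕ-monoʳ-≤ (ℚP.<⇒≤ 1<x) m<n)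
  where
  x^m<x^[1+m] : x ^ℕ m <ℚ x ^ℕ suc m
  x^m<x^[1+m] = subst (_<ℚ x ^ℕ suc m) (ℚP.*-identityˡ (x ^ℕ m))
    (*-monoʳ-<-0< (x ^ℕ m) (0<^ℕ (ℚP.<-trans (ℚP.positive⁻¹ 1ℚ) 1<x) m) 1<x)

x^[pred-n]≤x^n-x^m : ∀ {x m n} → toℚ 2 ≤ℚ x → m < n → x ^ℕ pred n ≤ℚ x ^ℕ n -ℚ x ^ℕ m
x^[pred-n]≤x^n-x^m {x} {m} {suc n} 2≤x (s≤s m≤n) = p+r≤q⇒p≤q-r (begin
  x ^ℕ n +ℚ x ^ℕ m       ≤⟨ ℚP.+-monoʳ-≤ (x ^ℕ n) (^ℕ-monoʳ-≤ 1≤x m≤n) ⟩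
  x ^ℕ n +ℚ x ^ℕ n       ≡⟨ solve 1 (λ y → y :+ y := con (toℚ 2) :* y) refl (x ^ℕ n) ⟩
  toℚ 2 *ℚ x ^ℕ n        ≤⟨ *-monoʳ-≤-0≤ (x ^ℕ n) (ℚP.≤-trans (ℚP.nonNegative⁻¹ 1ℚ) (1≤^ℕ 1≤x n)) 2≤x ⟩
  x *ℚ x ^ℕ n            ∎)
  where
  open ℚP.≤-Reasoning
  open ℚSolver.+-*-Solver
  1≤x : 1ℚ ≤ℚ x
  1≤x = ℚP.≤-trans (toℚ-mono-≤ {1} {2} (s≤s z≤n)) 2≤x

^ℤ[+m-+n]*^ℕn≡^ℕm : ∀ {x} → 0ℚ <ℚ x → ∀ m n → (x ^ℤ (+ m -ℤ + n)) *ℚ x ^ℕ n ≡ x ^ℕ m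
^ℤ[+m-+n]*^ℕn≡^ℕm {x} 0<x m n = trans (cong (λ z → (x ^ℤ z) *ℚ x ^ℕ n) (ℤP.[+m]-[+n]≡m⊖n m n)) (x^[m⊖n]*x^n≡x^m m n)
  where
  open ≡-Reasoning
  x^[m⊖n]*x^n≡x^m : ∀ m n → (x ^ℤ (m ⊖ n)) *ℚ x ^ℕ n ≡ x ^ℕ m
  x^[m⊖n]*x^n≡x^m m zero = ℚP.*-identityʳ (x ^ℕ m)
  x^[m⊖n]*x^n≡x^m zero (suc n) = /'-*-cancelʳ 1ℚ (0<⇒≢0 (0<^ℕ 0<x (suc n)))
  x^[m⊖n]*x^n≡x^m (suc m) (suc n) = begin
    (x ^ℤ (suc m ⊖ suc n)) *ℚ (x *ℚ x ^ℕ n)  ≡⟨ cong (λ z → (x ^ℤ z) *ℚ (x *ℚ x ^ℕ n)) (ℤP.[1+m]⊖[1+n]≡m⊖n m n) ⟩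
    (x ^ℤ (m ⊖ n)) *ℚ (x *ℚ x ^ℕ n)          ≡⟨ solve 3 (λ a b c → a :* (b :* c) := b :* (a :* c)) refl (x ^ℤ (m ⊖ n)) x (x ^ℕ n) ⟩
    x *ℚ ((x ^ℤ (m ⊖ n)) *ℚ x ^ℕ n)          ≡⟨ cong (x *ℚ_) (x^[m⊖n]*x^n≡x^m m n) ⟩
    x *ℚ x ^ℕ m                              ∎
    where open ℚSolver.+-*-Solver

gauss-suc : ∀ x m k →
  gauss x (suc m) (suc k) ≡ ((x ^ℕ suc m -ℚ 1ℚ) /' (x ^ℕ suc k -ℚ 1ℚ)) *ℚ gauss x m k
gauss-suc x m zero = refl
gauss-suc x m (suc k) = cong (((x ^ℕ suc m -ℚ 1ℚ) /' (x ^ℕ suc (suc k) -ℚ 1ℚ)) *ℚ_)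
  (trans (cong prodℚ (map-applyUpTo suc (factor (suc m) (suc (suc k))) (suc k)))
         (sym (cong prodℚ (map-upTo (factor m (suc k)) (suc k)))))
  where
  factor : ℕ → ℕ → ℕ → ℚ
  factor m k t = (x ^ℕ (m ∸ t) -ℚ 1ℚ) /' (x ^ℕ (k ∸ t) -ℚ 1ℚ)

module GaussianBinomial {q : ℚ} (1<q : 1ℚ <ℚ q) where

  1≤q : 1ℚ ≤ℚ q
  1≤q = ℚP.<⇒≤ 1<q

  0<q : 0ℚ <ℚ q
  0<q = ℚP.<-trans (ℚP.positive⁻¹ 1ℚ) 1<q

  0<q^ : ∀ m → 0ℚ <ℚ q ^ℕ m
  0<q^ = 0<^ℕ 0<q

  0≤q^ : ∀ m → 0ℚ ≤ℚ q ^ℕ m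
  0≤q^ m = ℚP.<⇒≤ (0<q^ m)

  q^[m∸n]≤[q^m-1]/[q^n-1] : ∀ {m n} → suc n ≤ m →
    q ^ℕ (m ∸ suc n) ≤ℚ (q ^ℕ m -ℚ 1ℚ) /' (q ^ℕ suc n -ℚ 1ℚ)
  q^[m∸n]≤[q^m-1]/[q^n-1] {m} {n} n<m = *-cancelʳ-≤-0< y 0<y (begin
    q ^ℕ (m ∸ suc n) *ℚ y                          ≡⟨ solve 2 (λ a b → a :* (b :- con 1ℚ) := a :* b :- a) refl (q ^ℕ (m ∸ suc n)) (q ^ℕ suc n) ⟩
    q ^ℕ (m ∸ suc n) *ℚ q ^ℕ suc n -ℚ q ^ℕ (m ∸ suc n)  ≡⟨ cong (_-ℚ q ^ℕ (m ∸ suc n)) (trans (sym (^ℕ-+ q (m ∸ suc n) (suc n))) (cong (q ^ℕ_) (ℕP.m∸n+n≡m n<m))) ⟩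
    q ^ℕ m -ℚ q ^ℕ (m ∸ suc n)                     ≤⟨ ℚP.+-monoʳ-≤ (q ^ℕ m) (ℚP.neg-antimono-≤ (1≤^ℕ 1≤q (m ∸ suc n))) ⟩
    q ^ℕ m -ℚ 1ℚ                                   ≡⟨ sym (/'-*-cancelʳ (q ^ℕ m -ℚ 1ℚ) (0<⇒≢0 0<y)) ⟩
    ((q ^ℕ m -ℚ 1ℚ) /' y) *ℚ y                     ∎)
    where
    open ℚP.≤-Reasoning
    open ℚSolver.+-*-Solver
    y = q ^ℕ suc n -ℚ 1ℚ
    0<y : 0ℚ <ℚ y
    0<y = p<q⇒0<q-p (^ℕ-monoʳ-< {n = suc n} 1<q (s≤s z≤n))

  0<gauss : ∀ {m k} → k ≤ m → 0ℚ <ℚ gauss q m k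
  0<gauss {m} {zero} _ = ℚP.positive⁻¹ 1ℚ
  0<gauss {suc m} {suc k} (s≤s k≤m) = subst (0ℚ <ℚ_) (sym (gauss-suc q m k))
    (0<*0< (ℚP.<-≤-trans (0<q^ (m ∸ k)) (q^[m∸n]≤[q^m-1]/[q^n-1] (s≤s k≤m))) (0<gauss k≤m))

  gauss-suc-≥ : ∀ {m k} → k ≤ m → q ^ℕ (m ∸ k) *ℚ gauss q m k ≤ℚ gauss q (suc m) (suc k)
  gauss-suc-≥ {m} {k} k≤m = subst (q ^ℕ (m ∸ k) *ℚ gauss q m k ≤ℚ_) (sym (gauss-suc q m k))
    (*-monoʳ-≤-0≤ (gauss q m k) (ℚP.<⇒≤ (0<gauss k≤m)) (q^[m∸n]≤[q^m-1]/[q^n-1] (s≤s k≤m)))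

  gauss-suc-mono : ∀ {m k} → k ≤ m → gauss q m k ≤ℚ gauss q (suc m) (suc k)
  gauss-suc-mono {m} {k} k≤m = ℚP.≤-trans
    (subst (_≤ℚ q ^ℕ (m ∸ k) *ℚ gauss q m k) (ℚP.*-identityˡ (gauss q m k))
      (*-monoʳ-≤-0≤ (gauss q m k) (ℚP.<⇒≤ (0<gauss k≤m)) (1≤^ℕ 1≤q (m ∸ k))))
    (gauss-suc-≥ k≤m)

  gauss-shift-≥ : ∀ D {m k} → D ≤ k → k ≤ m → q ^ℕ (D * (m ∸ k)) *ℚ gauss q (m ∸ D) (k ∸ D) ≤ℚ gauss q m k
  gauss-shift-≥ zero _ _ = ℚP.≤-reflexive (ℚP.*-identityˡ _)
  gauss-shift-≥ (suc D) {suc m} {suc k} (s≤s D≤k) (s≤s k≤m) = begin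
    q ^ℕ (suc D * e) *ℚ gauss q (m ∸ D) (k ∸ D)            ≡⟨ cong (_*ℚ gauss q (m ∸ D) (k ∸ D)) (^ℕ-+ q e (D * e)) ⟩
    (q ^ℕ e *ℚ q ^ℕ (D * e)) *ℚ gauss q (m ∸ D) (k ∸ D)    ≡⟨ ℚP.*-assoc (q ^ℕ e) _ _ ⟩
    q ^ℕ e *ℚ (q ^ℕ (D * e) *ℚ gauss q (m ∸ D) (k ∸ D))    ≤⟨ *-monoˡ-≤-0≤ (q ^ℕ e) (0≤q^ e) (gauss-shift-≥ D D≤k k≤m) ⟩
    q ^ℕ e *ℚ gauss q m k                                  ≤⟨ gauss-suc-≥ k≤m ⟩
    gauss q (suc m) (suc k)                                ∎
    where
    open ℚP.≤-Reasoning
    e = m ∸ k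

  q^[a-b] : ℕ → ℕ → ℚ
  q^[a-b] a b = q ^ℤ (+ a -ℤ + b)

  q^[a-b]*q^b≡q^a : ∀ a b → q^[a-b] a b *ℚ q ^ℕ b ≡ q ^ℕ a
  q^[a-b]*q^b≡q^a = ^ℤ[+m-+n]*^ℕn≡^ℕm 0<q

  0<q^[a-b] : ∀ a b → 0ℚ <ℚ q^[a-b] a b
  0<q^[a-b] a b = *-cancelʳ-<-0< (q ^ℕ b) (0<q^ b)
    (subst₂ _<ℚ_ (sym (ℚP.*-zeroˡ (q ^ℕ b))) (sym (q^[a-b]*q^b≡q^a a b)) (0<q^ a))

  q^[a-b]-mono-≤ : ∀ {a b c d} → a + d ≤ c + b → q^[a-b] a b ≤ℚ q^[a-b] c d
  q^[a-b]-mono-≤ {a} {b} {c} {d} a+d≤c+b = *-cancelʳ-≤-0< (q ^ℕ b *ℚ q ^ℕ d) (0<*0< (0<q^ b) (0<q^ d)) (begin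
    q^[a-b] a b *ℚ (q ^ℕ b *ℚ q ^ℕ d)    ≡⟨ sym (ℚP.*-assoc (q^[a-b] a b) _ _) ⟩
    (q^[a-b] a b *ℚ q ^ℕ b) *ℚ q ^ℕ d    ≡⟨ cong (_*ℚ q ^ℕ d) (q^[a-b]*q^b≡q^a a b) ⟩
    q ^ℕ a *ℚ q ^ℕ d                     ≡⟨ sym (^ℕ-+ q a d) ⟩
    q ^ℕ (a + d)                         ≤⟨ ^ℕ-monoʳ-≤ 1≤q a+d≤c+b ⟩
    q ^ℕ (c + b)                         ≡⟨ ^ℕ-+ q c b ⟩
    q ^ℕ c *ℚ q ^ℕ b                     ≡⟨ cong (_*ℚ q ^ℕ b) (sym (q^[a-b]*q^b≡q^a c d)) ⟩
    (q^[a-b] c d *ℚ q ^ℕ d) *ℚ q ^ℕ b    ≡⟨ solve 3 (λ p u v → (p :* v) :* u := p :* (u :* v)) refl (q^[a-b] c d) (q ^ℕ b) (q ^ℕ d) ⟩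
    q^[a-b] c d *ℚ (q ^ℕ b *ℚ q ^ℕ d)    ∎)
    where
    open ℚP.≤-Reasoning
    open ℚSolver.+-*-Solver

  term : ℕ → ℕ → ℕ → ℚ
  term n k i = q^[a-b] (i C 2) (k * i) *ℚ gauss q (n ∸ k ∸ i) (k ∸ i)

  term-suc-≤ : ∀ {n k i} → suc i ≤ k → k ≤ n ∸ k → term n k (suc i) ≤ℚ term n k i
  term-suc-≤ {n} {k} {i} i<k k≤N = *-mono-≤-0≤ (ℚP.<⇒≤ (0<q^[a-b] (suc i C 2) (k * suc i)))
    (ℚP.<⇒≤ (0<gauss (ℕP.∸-monoˡ-≤ i k≤N))) (q^[a-b]-mono-≤ {suc i C 2} {k * suc i} exponents) gauss-step
    where
    N = n ∸ k
    exponents : suc i C 2 + k * i ≤ i C 2 + k * suc i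
    exponents = begin
      suc i C 2 + k * i    ≡⟨ cong (_+ k * i) (suc[n]C2≡n+nC2 i) ⟩
      i + i C 2 + k * i    ≡⟨ solve 3 (λ i c ki → i :+ c :+ ki := c :+ (i :+ ki)) refl i (i C 2) (k * i) ⟩
      i C 2 + (i + k * i)  ≤⟨ ℕP.+-monoʳ-≤ (i C 2) (ℕP.+-monoˡ-≤ (k * i) (ℕP.<⇒≤ i<k)) ⟩
      i C 2 + (k + k * i)  ≡⟨ cong (_+_ (i C 2)) (sym (ℕP.*-suc k i)) ⟩
      i C 2 + k * suc i    ∎
      where
      open ℕP.≤-Reasoning
      open ℕSolver.+-*-Solver
    gauss-step : gauss q (N ∸ suc i) (k ∸ suc i) ≤ℚ gauss q (N ∸ i) (k ∸ i)
    gauss-step = subst₂ (λ a b → gauss q (N ∸ suc i) (k ∸ suc i) ≤ℚ gauss q a b)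
      (sym (ℕP.+-∸-assoc 1 (ℕP.≤-trans i<k k≤N))) (sym (ℕP.+-∸-assoc 1 i<k))
      (gauss-suc-mono (ℕP.∸-monoˡ-≤ (suc i) k≤N))

  term-antitone : ∀ {n k i j} → j ≤′ i → i ≤ k → k ≤ n ∸ k → term n k i ≤ℚ term n k j
  term-antitone ≤′-refl _ _ = ℚP.≤-refl
  term-antitone (≤′-step j≤′i) i≤k k≤N = ℚP.≤-trans (term-suc-≤ i≤k k≤N) (term-antitone j≤′i (ℕP.<⇒≤ i≤k) k≤N)

  term-<-ratio : ∀ {n k d} → toℚ 2 ≤ℚ q → 1 ≤ d → d + 1 ≤ k → k + k < n →
    term n k (d + 1) <ℚ ((q ^ℕ k -ℚ q ^ℕ d) /' (q ^ℕ n -ℚ q ^ℕ k)) *ℚ gauss q (n ∸ k) k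
  term-<-ratio {n} {k} {d} 2≤q 1≤d D≤k k+k<n = begin-strict
    q^[a-b] c kD *ℚ g             <⟨ *-monoʳ-<-0< g (0<gauss (ℕP.∸-monoˡ-≤ D k≤N)) key ⟩
    (X *ℚ q ^ℕ Dm) *ℚ g           ≡⟨ ℚP.*-assoc X (q ^ℕ Dm) g ⟩
    X *ℚ (q ^ℕ Dm *ℚ g)           ≤⟨ *-monoˡ-≤-0≤ X (ℚP.<⇒≤ 0<X) (gauss-shift-≥ D D≤k k≤N) ⟩
    X *ℚ gauss q (n ∸ k) k        ∎
    where
    open ℚP.≤-Reasoning
    D = d + 1
    c = D C 2
    kD = k * D
    Dm = D * (n ∸ k ∸ k)
    g = gauss q (n ∸ k ∸ D) (k ∸ D)
    k≤N : k ≤ n ∸ k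
    k≤N = ℕP.m+n≤o⇒m≤o∸n k (ℕP.<⇒≤ k+k<n)
    d<k : d < k
    d<k = subst (_≤ k) (ℕP.+-comm d 1) D≤k
    Z = q ^ℕ n -ℚ q ^ℕ k
    0<Z : 0ℚ <ℚ Z
    0<Z = p<q⇒0<q-p (^ℕ-monoʳ-< 1<q (ℕP.≤-trans (s≤s (ℕP.m≤m+n k k)) k+k<n))
    X = (q ^ℕ k -ℚ q ^ℕ d) /' Z
    0<X : 0ℚ <ℚ X
    0<X = 0</'0< (p<q⇒0<q-p (^ℕ-monoʳ-< 1<q d<k)) 0<Z
    key : q^[a-b] c kD <ℚ X *ℚ q ^ℕ Dm
    key = *-cancelʳ-<-0< (q ^ℕ kD *ℚ Z) (0<*0< (0<q^ kD) 0<Z) (begin-strict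
      q^[a-b] c kD *ℚ (q ^ℕ kD *ℚ Z)          ≡⟨ sym (ℚP.*-assoc (q^[a-b] c kD) _ _) ⟩
      (q^[a-b] c kD *ℚ q ^ℕ kD) *ℚ Z          ≡⟨ cong (_*ℚ Z) (q^[a-b]*q^b≡q^a c kD) ⟩
      q ^ℕ c *ℚ Z                             <⟨ *-monoˡ-<-0< (q ^ℕ c) (0<q^ c) (0<p⇒q-p<q (0<q^ k)) ⟩
      q ^ℕ c *ℚ q ^ℕ n                        ≡⟨ sym (^ℕ-+ q c n) ⟩
      q ^ℕ (c + n)                            ≤⟨ ^ℕ-monoʳ-≤ 1≤q (exponent-bound (ℕP.+-monoˡ-≤ 1 1≤d) D≤k k+k<n) ⟩
      q ^ℕ (pred k + (Dm + kD))               ≡⟨ trans (^ℕ-+ q (pred k) _) (cong (q ^ℕ pred k *ℚ_) (^ℕ-+ q Dm kD)) ⟩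
      q ^ℕ pred k *ℚ (q ^ℕ Dm *ℚ q ^ℕ kD)     ≤⟨ *-monoʳ-≤-0≤ _ (ℚP.<⇒≤ (0<*0< (0<q^ Dm) (0<q^ kD))) (x^[pred-n]≤x^n-x^m 2≤q d<k) ⟩
      (q ^ℕ k -ℚ q ^ℕ d) *ℚ (q ^ℕ Dm *ℚ q ^ℕ kD)  ≡⟨ cong (_*ℚ (q ^ℕ Dm *ℚ q ^ℕ kD)) (sym (/'-*-cancelʳ _ (0<⇒≢0 0<Z))) ⟩
      (X *ℚ Z) *ℚ (q ^ℕ Dm *ℚ q ^ℕ kD)        ≡⟨ solve 4 (λ x z u v → (x :* z) :* (u :* v) := (x :* u) :* (v :* z)) refl X Z (q ^ℕ Dm) (q ^ℕ kD) ⟩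
      (X *ℚ q ^ℕ Dm) *ℚ (q ^ℕ kD *ℚ Z)        ∎)
      where open ℚSolver.+-*-Solver

lemmaA1 : (q n k d i : ℕ) → IsPrimePower q → 1 ≤ d → d + 1 ≤ i → i ≤ k → 2 * k + 1 ≤ n →
    ((toℚ q ^ℤ ((+ (i C 2)) -ℤ (+ (k * i)))) *ℚ gauss (toℚ q) (n ∸ k ∸ i) (k ∸ i)
      ≤ℚ (toℚ q ^ℤ ((+ ((d + 1) C 2)) -ℤ (+ (k * (d + 1))))) *ℚ gauss (toℚ q) (n ∸ k ∸ (d + 1)) (k ∸ (d + 1)))
    × ((toℚ q ^ℤ ((+ ((d + 1) C 2)) -ℤ (+ (k * (d + 1))))) *ℚ gauss (toℚ q) (n ∸ k ∸ (d + 1)) (k ∸ (d + 1))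
      <ℚ (((toℚ q ^ℕ k) -ℚ (toℚ q ^ℕ d)) /' ((toℚ q ^ℕ n) -ℚ (toℚ q ^ℕ k))) *ℚ gauss (toℚ q) (n ∸ k) k)
lemmaA1 q n k d i q-prime-power 1≤d d+1≤i i≤k 2k+1≤n =
    term-antitone (ℕP.≤⇒≤′ d+1≤i) i≤k (ℕP.m+n≤o⇒m≤o∸n k (ℕP.<⇒≤ k+k<n))
  , term-<-ratio 2≤q 1≤d (ℕP.≤-trans d+1≤i i≤k) k+k<n
  where
  k+k<n : k + k < n
  k+k<n = 2*k+1≤n⇒k+k<n {k} 2k+1≤n
  2≤q : toℚ 2 ≤ℚ toℚ q
  2≤q = toℚ-mono-≤ (prime-power⇒2≤ q-prime-power)
  open GaussianBinomial (ℚP.<-≤-trans (*<* (ℤ.+<+ (s≤s (s≤s z≤n)))) 2≤q)
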